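{- Let $\mathcal{M}=(Q,r)$ be a matroid and let $X,Y\subseteq Q$ be a disjoint nonmodular pair of flats such that $X\cup Y$ is a circuit. Then $X$ is a quasi-intersection of $(X,Y)$.
   Context: Write $AB=A\cup B$ and $r(A|B)=r(AB)-r(B)$. A flat is a set $F$ with $r(Fx)>r(F)$ for all $x\notin F$; flats $X,Y$ are modular if $r(X)+r(Y)=r(XY)+r(X\cap Y)$, nonmodular otherwise. A circuit is a minimal dependent set. A quasi-intersection of a nonmodular pair of flats $(X,Y)$ is a flat $T$ with (DL1) $r(T|X)=0$ and (DL2) for every flat $X'\subseteq X$: $r(T|X')=0$ if and only if $r(Y|X')=r(Y|X)$. -}

module Defs where

open import Data.Nat using (ℕ; _+_; _∸_; _≤_; _<_)
open import Data.Fin using (Fin)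
open import Data.Fin.Subset using (Subset; _∪_; _∩_; _⊆_; _⊂_; _∉_; ⁅_⁆; ∣_∣; ⊥)
open import Data.Product using (_×_)
open import Relation.Nullary using (¬_)
open import Relation.Binary.PropositionalEquality using (_≡_)
open import Function.Bundles using (_⇔_)

record Matroid (n : ℕ) : Set where
  field
    r         : Subset n → ℕ
    r-bounded : ∀ A → r A ≤ ∣ A ∣
    r-mono    : ∀ A B → A ⊆ B → r A ≤ r B
    r-submod  : ∀ A B → r (A ∪ B) + r (A ∩ B) ≤ r A + r B

module _ {n : ℕ} (M : Matroid n) where
  open Matroid M

  r∣ : Subset n → Subset n → ℕ
  r∣ A B = r (A ∪ B) ∸ r B

  Flat : Subset n → Set
  Flat F = ∀ x → x ∉ F → r F < r (F ∪ ⁅ x ⁆)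

  Modular : Subset n → Subset n → Set
  Modular X Y = r X + r Y ≡ r (X ∪ Y) + r (X ∩ Y)

  NonmodularPairOfFlats : Subset n → Subset n → Set
  NonmodularPairOfFlats X Y = Flat X × Flat Y × ¬ Modular X Y

  Dependent : Subset n → Set
  Dependent A = r A < ∣ A ∣

  Circuit : Subset n → Set
  Circuit C = Dependent C × (∀ D → D ⊂ C → ¬ Dependent D)

  QuasiIntersection : Subset n → Subset n → Subset n → Set
  QuasiIntersection X Y T =
    Flat T
    × r∣ T X ≡ 0
    × (∀ X' → Flat X' → X' ⊆ X → (r∣ T X' ≡ 0 ⇔ r∣ Y X' ≡ r∣ Y X))

-- Y is nonempty (otherwise (X, Y) would be modular), so X is a proper subset
-- of the circuit X ∪ Y and hence independent, which gives r(Y|X) < |Y|.  A flat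
-- X' ⊆ X has r(X|X') = 0 exactly when X' = X.  If instead X' ⊊ X, then
-- Y ∪ X' is again a proper subset of the circuit, so it is independent and
-- r(Y|X') ≥ |Y| > r(Y|X).  Hence both sides of (DL2) say X' = X.
module Submission where

open import Defs
open import Data.Nat using (ℕ; suc; _+_; _∸_; _≤_; _<_)
open import Data.Nat.Properties
  using (+-suc; +-comm; +-identityʳ; +-monoʳ-≤; m≤m+n; <-≤-trans; n≤0⇒n≡0; <⇒≱;
         m∸n≡0⇒m≤n; n∸n≡0; ≮⇒≥; >⇒≢; ∸-monoˡ-<; m+n∸m≡n; m+n≤o⇒m≤o∸n; module ≤-Reasoning)
open import Data.Fin.Subset using (Subset; _∪_; _∩_; ⊥; _⊆_; _⊂_; _∈_; _∉_; ∣_∣; ⁅_⁆; Nonempty; inside; outside)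
open import Data.Fin.Subset.Properties
  using (_∈?_; _⊂?_; nonempty?; Empty-unique; ∉⊥; ∣⊥∣≡0; x∈⁅y⁆⇒x≡y; ⊆-antisym; ⊆-reflexive; ⊂-⊆-trans;
         x∈p∩q⁺; x∈p∩q⁻; p⊆p∪q; q⊆p∪q; x∈p∪q⁻; ∪-comm; ∪-idem; ∪-identityʳ; ∩-comm; ∩-zeroʳ)
open import Data.Vec using ([]; _∷_)
open import Data.Product using (_,_)
open import Data.Empty using (⊥-elim)
open import Data.Sum using (_⊎_; inj₁; inj₂)
open import Relation.Nullary using (¬_; yes; no; contradiction)
open import Relation.Binary.PropositionalEquality using (_≡_; refl; sym; trans; cong; subst; module ≡-Reasoning)
open import Function.Bundles using (_⇔_; mk⇔)
open import Function.Construct.Composition using (_⇔-∘_)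
open import Function.Construct.Symmetry using (⇔-sym)

private
  variable
    n : ℕ
    p p′ q t : Subset n

∣p∪q∣+∣p∩q∣≡∣p∣+∣q∣ : (p q : Subset n) → ∣ p ∪ q ∣ + ∣ p ∩ q ∣ ≡ ∣ p ∣ + ∣ q ∣
∣p∪q∣+∣p∩q∣≡∣p∣+∣q∣ []            []            = refl
∣p∪q∣+∣p∩q∣≡∣p∣+∣q∣ (inside  ∷ p) (inside  ∷ q) =
  cong suc (trans (+-suc _ _) (trans (cong suc (∣p∪q∣+∣p∩q∣≡∣p∣+∣q∣ p q)) (sym (+-suc _ _))))
∣p∪q∣+∣p∩q∣≡∣p∣+∣q∣ (inside  ∷ p) (outside ∷ q) = cong suc (∣p∪q∣+∣p∩q∣≡∣p∣+∣q∣ p q)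
∣p∪q∣+∣p∩q∣≡∣p∣+∣q∣ (outside ∷ p) (inside  ∷ q) =
  trans (cong suc (∣p∪q∣+∣p∩q∣≡∣p∣+∣q∣ p q)) (sym (+-suc _ _))
∣p∪q∣+∣p∩q∣≡∣p∣+∣q∣ (outside ∷ p) (outside ∷ q) = ∣p∪q∣+∣p∩q∣≡∣p∣+∣q∣ p q

∣p∪q∣≤∣p∣+∣q∣ : (p q : Subset n) → ∣ p ∪ q ∣ ≤ ∣ p ∣ + ∣ q ∣
∣p∪q∣≤∣p∣+∣q∣ p q = subst (∣ p ∪ q ∣ ≤_) (∣p∪q∣+∣p∩q∣≡∣p∣+∣q∣ p q) (m≤m+n _ _)

p∩q≡⊥⇒∣p∪q∣≡∣p∣+∣q∣ : p ∩ q ≡ ⊥ → ∣ p ∪ q ∣ ≡ ∣ p ∣ + ∣ q ∣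
p∩q≡⊥⇒∣p∪q∣≡∣p∣+∣q∣ {n} {p} {q} p∩q≡⊥ = begin
  ∣ p ∪ q ∣              ≡⟨ sym (+-identityʳ _) ⟩
  ∣ p ∪ q ∣ + 0          ≡⟨ cong (∣ p ∪ q ∣ +_) (sym (∣⊥∣≡0 n)) ⟩
  ∣ p ∪ q ∣ + ∣ ⊥ {n} ∣  ≡⟨ cong (λ s → ∣ p ∪ q ∣ + ∣ s ∣) (sym p∩q≡⊥) ⟩
  ∣ p ∪ q ∣ + ∣ p ∩ q ∣  ≡⟨ ∣p∪q∣+∣p∩q∣≡∣p∣+∣q∣ p q ⟩
  ∣ p ∣ + ∣ q ∣          ∎
  where open ≡-Reasoning

p∩q≡⊥⇒x∈p⇒x∉q : p ∩ q ≡ ⊥ → ∀ {x} → x ∈ p → x ∉ q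
p∩q≡⊥⇒x∈p⇒x∉q p∩q≡⊥ x∈p x∈q = ∉⊥ (subst (_ ∈_) p∩q≡⊥ (x∈p∩q⁺ (x∈p , x∈q)))

p∩q≡⊥⇒p′∩q≡⊥ : p ∩ q ≡ ⊥ → p′ ⊆ p → p′ ∩ q ≡ ⊥
p∩q≡⊥⇒p′∩q≡⊥ {q = q} {p′ = p′} p∩q≡⊥ p′⊆p = Empty-unique λ where
  (x , x∈p′∩q) → let x∈p′ , x∈q = x∈p∩q⁻ p′ q x∈p′∩q in p∩q≡⊥⇒x∈p⇒x∉q p∩q≡⊥ (p′⊆p x∈p′) x∈q

∪-lub : p ⊆ t → q ⊆ t → p ∪ q ⊆ t
∪-lub {p = p} {q = q} p⊆t q⊆t x∈p∪q with x∈p∪q⁻ p q x∈p∪q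
... | inj₁ x∈p = p⊆t x∈p
... | inj₂ x∈q = q⊆t x∈q

p∩q≡⊥⇒p⊂p∪q : p ∩ q ≡ ⊥ → Nonempty q → p ⊂ p ∪ q
p∩q≡⊥⇒p⊂p∪q {p = p} {q = q} p∩q≡⊥ (x , x∈q) =
  p⊆p∪q q , x , q⊆p∪q p q x∈q , λ x∈p → p∩q≡⊥⇒x∈p⇒x∉q p∩q≡⊥ x∈p x∈q

∪-monoʳ-⊂ : t ∩ p ≡ ⊥ → q ⊂ t → p ∪ q ⊂ p ∪ t
∪-monoʳ-⊂ {t = t} {p = p} {q = q} t∩p≡⊥ (q⊆t , x , x∈t , x∉q) =
  ∪-lub (p⊆p∪q t) (λ x∈q → q⊆p∪q p t (q⊆t x∈q)) , x , q⊆p∪q p t x∈t , x∉p∪q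
  where
  x∉p∪q : x ∉ p ∪ q
  x∉p∪q x∈p∪q with x∈p∪q⁻ p q x∈p∪q
  ... | inj₁ x∈p = p∩q≡⊥⇒x∈p⇒x∉q t∩p≡⊥ x∈t x∈p
  ... | inj₂ x∈q = x∉q x∈q

⊆⇒≡⊎⊂ : p ⊆ q → p ≡ q ⊎ p ⊂ q
⊆⇒≡⊎⊂ {p = p} {q = q} p⊆q with p ⊂? q
... | yes p⊂q = inj₂ p⊂q
... | no  p⊄q = inj₁ (⊆-antisym p⊆q q⊆p)
  where
  q⊆p : q ⊆ p
  q⊆p {x} x∈q with x ∈? p
  ... | yes x∈p = x∈p
  ... | no  x∉p = ⊥-elim (p⊄q (p⊆q , x , x∈q , x∉p))

module MatroidProperties {n : ℕ} (M : Matroid n) where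
  open Matroid M

  Independent : Subset n → Set
  Independent A = ∣ A ∣ ≤ r A

  r⊥≡0 : r ⊥ ≡ 0
  r⊥≡0 = n≤0⇒n≡0 (subst (r ⊥ ≤_) (∣⊥∣≡0 n) (r-bounded ⊥))

  modular-⊥ : ∀ X → Modular M X ⊥
  modular-⊥ X rewrite ∪-identityʳ X | ∩-zeroʳ X = refl

  nonmodular⇒nonempty : ∀ {X Y} → ¬ Modular M X Y → Nonempty Y
  nonmodular⇒nonempty {X} {Y} nonmodular with nonempty? Y
  ... | yes Y-nonempty = Y-nonempty
  ... | no  Y-empty =
    contradiction (subst (Modular M X) (sym (Empty-unique Y-empty)) (modular-⊥ X)) nonmodular

  r∣-self : ∀ A → r∣ M A A ≡ 0
  r∣-self A rewrite ∪-idem A = n∸n≡0 (r A)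

  flat-r∣≡0⇒⊆ : ∀ {A F} → Flat M F → r∣ M A F ≡ 0 → A ⊆ F
  flat-r∣≡0⇒⊆ {A} {F} flat r∣≡0 {x} x∈A with x ∈? F
  ... | yes x∈F = x∈F
  ... | no  x∉F =
    contradiction (m∸n≡0⇒m≤n r∣≡0) (<⇒≱ (<-≤-trans (flat x x∉F) (r-mono _ _ Fx⊆AF)))
    where
    Fx⊆AF : F ∪ ⁅ x ⁆ ⊆ A ∪ F
    Fx⊆AF = ∪-lub (q⊆p∪q A F) λ y∈⁅x⁆ → subst (_∈ A ∪ F) (sym (x∈⁅y⁆⇒x≡y x y∈⁅x⁆)) (p⊆p∪q F x∈A)

  flat-r∣≡0⇔≡ : ∀ {A F} → Flat M F → F ⊆ A → (r∣ M A F ≡ 0 ⇔ F ≡ A)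
  flat-r∣≡0⇔≡ {A} flat F⊆A =
    mk⇔ (λ r∣≡0 → ⊆-antisym F⊆A (flat-r∣≡0⇒⊆ flat r∣≡0)) (λ { refl → r∣-self A })

  circuit-⊂⇒independent : ∀ {C D} → Circuit M C → D ⊂ C → Independent D
  circuit-⊂⇒independent (_ , minimal) D⊂C = ≮⇒≥ (minimal _ D⊂C)

  independent⇒∣A∣≤r∣ : ∀ {A B} → Independent (A ∪ B) → A ∩ B ≡ ⊥ → ∣ A ∣ ≤ r∣ M A B
  independent⇒∣A∣≤r∣ {A} {B} independent A∩B≡⊥ = m+n≤o⇒m≤o∸n ∣ A ∣ (begin
    ∣ A ∣ + r B      ≤⟨ +-monoʳ-≤ ∣ A ∣ (r-bounded B) ⟩
    ∣ A ∣ + ∣ B ∣    ≡⟨ p∩q≡⊥⇒∣p∪q∣≡∣p∣+∣q∣ A∩B≡⊥ ⟨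
    ∣ A ∪ B ∣        ≤⟨ independent ⟩
    r (A ∪ B)        ∎)
    where open ≤-Reasoning

  dependent⇒r∣<∣A∣ : ∀ {A B} → Dependent M (A ∪ B) → Independent B → r∣ M A B < ∣ A ∣
  dependent⇒r∣<∣A∣ {A} {B} dependent independent =
    subst (r∣ M A B <_) (m+n∸m≡n (r B) ∣ A ∣)
          (∸-monoˡ-< r[A∪B]<rB+∣A∣ (r-mono B (A ∪ B) (q⊆p∪q A B)))
    where
    r[A∪B]<rB+∣A∣ : r (A ∪ B) < r B + ∣ A ∣
    r[A∪B]<rB+∣A∣ = begin-strict
      r (A ∪ B)        <⟨ dependent ⟩
      ∣ A ∪ B ∣        ≤⟨ ∣p∪q∣≤∣p∣+∣q∣ A B ⟩
      ∣ A ∣ + ∣ B ∣    ≤⟨ +-monoʳ-≤ ∣ A ∣ independent ⟩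
      ∣ A ∣ + r B      ≡⟨ +-comm ∣ A ∣ (r B) ⟩
      r B + ∣ A ∣      ∎
      where open ≤-Reasoning

  circuit-split-r∣-⊂ : ∀ {X Y X′} → Circuit M (X ∪ Y) → X ∩ Y ≡ ⊥ → Nonempty Y →
                       X′ ⊂ X → r∣ M Y X < r∣ M Y X′
  circuit-split-r∣-⊂ {X} {Y} {X′} circuit@(dependent , _) X∩Y≡⊥ Y-nonempty X′⊂X@(X′⊆X , _) =
    begin-strict
      r∣ M Y X   <⟨ dependent⇒r∣<∣A∣ (subst (Dependent M) (∪-comm X Y) dependent) independentX ⟩
      ∣ Y ∣      ≤⟨ independent⇒∣A∣≤r∣ independentY∪X′ Y∩X′≡⊥ ⟩
      r∣ M Y X′  ∎
    where
    open ≤-Reasoning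
    independentX : Independent X
    independentX = circuit-⊂⇒independent circuit (p∩q≡⊥⇒p⊂p∪q X∩Y≡⊥ Y-nonempty)
    independentY∪X′ : Independent (Y ∪ X′)
    independentY∪X′ =
      circuit-⊂⇒independent circuit (⊂-⊆-trans (∪-monoʳ-⊂ X∩Y≡⊥ X′⊂X) (⊆-reflexive (∪-comm Y X)))
    Y∩X′≡⊥ : Y ∩ X′ ≡ ⊥
    Y∩X′≡⊥ = trans (∩-comm Y X′) (p∩q≡⊥⇒p′∩q≡⊥ X∩Y≡⊥ X′⊆X)

  circuit-split-r∣≡⇔≡ : ∀ {X Y X′} → Circuit M (X ∪ Y) → X ∩ Y ≡ ⊥ → Nonempty Y →
                        X′ ⊆ X → (r∣ M Y X′ ≡ r∣ M Y X ⇔ X′ ≡ X)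
  circuit-split-r∣≡⇔≡ {X} {Y} {X′} circuit X∩Y≡⊥ Y-nonempty X′⊆X = mk⇔ r∣≡⇒≡ (λ { refl → refl })
    where
    r∣≡⇒≡ : r∣ M Y X′ ≡ r∣ M Y X → X′ ≡ X
    r∣≡⇒≡ r∣≡ with ⊆⇒≡⊎⊂ X′⊆X
    ... | inj₁ X′≡X = X′≡X
    ... | inj₂ X′⊂X = contradiction r∣≡ (>⇒≢ (circuit-split-r∣-⊂ circuit X∩Y≡⊥ Y-nonempty X′⊂X))

proposition5p9 : {n : ℕ} (M : Matroid n) (X Y : Subset n) →
    NonmodularPairOfFlats M X Y →
    X ∩ Y ≡ ⊥ →
    Circuit M (X ∪ Y) →
    QuasiIntersection M X Y X
proposition5p9 M X Y (flatX , _ , nonmodular) X∩Y≡⊥ circuit =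
  flatX , r∣-self X , λ X′ flatX′ X′⊆X →
    ⇔-sym (circuit-split-r∣≡⇔≡ circuit X∩Y≡⊥ Y-nonempty X′⊆X) ⇔-∘ flat-r∣≡0⇔≡ flatX′ X′⊆X
  where
  open MatroidProperties M
  Y-nonempty : Nonempty Y
  Y-nonempty = nonmodular⇒nonempty nonmodular
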